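{- Let $n$ be a positive integer and $k \in \{0,1,\dots,n\}$. Let $\mathcal{Q}_{n,k} \subset \mathbb{R}^n$ be defined by $x_i \ge 0$ for $1 \le i \le n$, $x_i \le 1$ for $1 \le i \le k$, and $x_1 + \cdots + x_n \le n$, and let $h(\tau_{n,k},t) = \sum_{i=0}^n h_i t^i$, where $h_i$ is the number of points of $\mathcal{Q}_{n,k} \cap \mathbb{N}^n$ with exactly $i$ nonzero coordinates. Then $$ h(\tau_{n,k},t) = \sum_{i=0}^{\lfloor n/2 \rfloor} \binom{n-k}{i}\binom{n-i}{i} t^i (1+t)^{n-2i}. $$ In particular, $h(\tau_{n,k},t)$ is $\gamma$-positive, and hence palindromic and unimodal.
   Context: $\mathbb{N} = \{0,1,2,\dots\}$. A polynomial of degree at most $n$ is $\gamma$-positive if it can be written as $\sum_{i=0}^{\lfloor n/2\rfloor} \gamma_i t^i(1+t)^{n-2i}$ with all $\gamma_i \ge 0$. Palindromic means $h_i = h_{n-i}$ for all $i$; unimodal means the coefficients weakly increase then weakly decrease. -}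

module Defs where

open import Data.Nat using (ℕ; zero; suc; _+_; _*_; _∸_; _≤_; _<_; _≤?_; _<?_; _≟_)
open import Data.Nat.Combinatorics using (_C_)
open import Data.Nat.Properties using ()
open import Data.Fin using (Fin; toℕ)
open import Data.Vec using (Vec; []; _∷_; lookup)
import Data.Vec as V
open import Data.List using (List; []; _∷_; concatMap; map; length; filter; upTo; foldr)
open import Data.Product using (Σ; ∃; _×_; _,_)
open import Relation.Nullary using (¬_; Dec; yes; no)
open import Relation.Nullary.Decidable using (_×-dec_; ¬?)
open import Relation.Binary.PropositionalEquality using (_≡_)
open import Data.Fin.Properties using (all?)

-- Polynomials with natural-number coefficients, as coefficient lists
-- (constant term first).  Two polynomials are equal iff all their
-- coefficients agree (`coeff`), so trailing zeros are irrelevant.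

Poly : Set
Poly = List ℕ

coeff : Poly → ℕ → ℕ
coeff []       _       = 0
coeff (a ∷ p)  zero    = a
coeff (a ∷ p)  (suc i) = coeff p i

infixl 6 _+ₚ_
infixl 7 _*ₚ_ _·ₚ_

_+ₚ_ : Poly → Poly → Poly
[]      +ₚ q       = q
(a ∷ p) +ₚ []      = a ∷ p
(a ∷ p) +ₚ (b ∷ q) = (a + b) ∷ (p +ₚ q)

_·ₚ_ : ℕ → Poly → Poly
c ·ₚ p = map (c *_) p

_*ₚ_ : Poly → Poly → Poly
[]      *ₚ q = []
(a ∷ p) *ₚ q = (a ·ₚ q) +ₚ (0 ∷ (p *ₚ q))

oneₚ : Poly
oneₚ = 1 ∷ []

tₚ : Poly
tₚ = 0 ∷ 1 ∷ []

_^ₚ_ : Poly → ℕ → Poly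
p ^ₚ zero  = oneₚ
p ^ₚ suc m = p *ₚ (p ^ₚ m)

sumₚ : ℕ → (ℕ → Poly) → Poly
sumₚ zero    f = f 0
sumₚ (suc m) f = sumₚ m f +ₚ f (suc m)

boxVecs : (n b : ℕ) → List (Vec ℕ n)
boxVecs zero    b = [] ∷ []
boxVecs (suc n) b = concatMap (λ x → map (x ∷_) (boxVecs n b)) (upTo (suc b))

vsum : ∀ {n} → Vec ℕ n → ℕ
vsum = V.foldr _ _+_ 0

nonzeros : ∀ {n} → Vec ℕ n → ℕ
nonzeros []      = 0
nonzeros (zero  ∷ v) = nonzeros v
nonzeros (suc _ ∷ v) = suc (nonzeros v)

-- membership in Q_{n,k} (for points of ℕ^n, so x_i ≥ 0 is automatic):
-- x_i ≤ 1 for the first k coordinates, and x_1 + ... + x_n ≤ n.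
InQ : (n k : ℕ) → Vec ℕ n → Set
InQ n k x = (∀ (j : Fin n) → toℕ j < k → lookup x j ≤ 1) × (vsum x ≤ n)

inQ? : (n k : ℕ) → (x : Vec ℕ n) → Dec (InQ n k x)
inQ? n k x = all? (λ j → dec j) ×-dec (vsum x ≤? n)
  where
  dec : (j : Fin n) → Dec (toℕ j < k → lookup x j ≤ 1)
  dec j with toℕ j <? k | lookup x j ≤? 1
  ... | _     | yes p = yes (λ _ → p)
  ... | no ¬q | no _  = yes (λ q → Data.Empty.⊥-elim (¬q q))
    where import Data.Empty
  ... | yes q | no ¬p = no (λ f → ¬p (f q))

-- The lattice points of Q_{n,k} ∩ ℕ^n.  Every such point has all
-- coordinates ≤ n (since their sum is ≤ n), so enumerating the box
-- [0,n]^n and filtering loses nothing.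
latticeQ : (n k : ℕ) → List (Vec ℕ n)
latticeQ n k = filter (inQ? n k) (boxVecs n n)

hcoeff : (n k i : ℕ) → ℕ
hcoeff n k i = length (filter (λ x → nonzeros x ≟ i) (latticeQ n k))

hpoly : (n k : ℕ) → Poly
hpoly n k = sumₚ n (λ i → hcoeff n k i ·ₚ (tₚ ^ₚ i))

GammaPositive : ℕ → Poly → Set
GammaPositive n p = Σ (ℕ → ℕ) λ γ →
  ∀ j → coeff p j ≡ coeff (sumₚ (Data.Nat._/_ n 2)
                              (λ i → γ i ·ₚ ((tₚ ^ₚ i) *ₚ ((oneₚ +ₚ tₚ) ^ₚ (n ∸ 2 * i))))) j
  where import Data.Nat

Palindromic : ℕ → Poly → Set
Palindromic n p = ∀ i → i ≤ n → coeff p i ≡ coeff p (n ∸ i)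

Unimodal : Poly → Set
Unimodal p = ∃ λ m → (∀ i → i < m → coeff p i ≤ coeff p (suc i))
                   × (∀ i → m ≤ i → coeff p (suc i) ≤ coeff p i)

-- Write n = k + m. Splitting off one coordinate at a time, the number of lattice points with j
-- nonzero coordinates obeys a Pascal-type recursion in k, whose solution is
-- Σ_{d+u=j} C(k,d) C(m,u) C(m+d,j); in the base case k = 0, with coordinate sum at most s, there
-- are C(m,j) C(s,j) points (the positions of the nonzero coordinates, then a composition of at
-- most s into j positive parts).
-- Two Vandermonde convolutions and the identity C(N,i) C(N-i,c) = C(N,i+c) C(i+c,i) turn this
-- into Σ_i C(m,i) C(j,i) C(n-i,j), which is the coefficient of t^j in
-- Σ_i C(m,i) C(n-i,i) t^i (1+t)^(n-2i). Each t^i (1+t)^(n-2i) is palindromic about n/2 and,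
-- by C(e,r+1) (r+1) = C(e,r) (e-r), unimodal, so every γ-positive polynomial is palindromic
-- and unimodal.

module Submission where

open import Defs
open import Data.Nat
open import Data.Nat.Properties
open import Data.Nat.Combinatorics
  using (_C_; k>n⇒nCk≡0; nCk+nC[k+1]≡[n+1]C[k+1]; nC1≡n; nCk≡nC[n∸k]; nCk≡n!/k![n-k]!; k![n∸k]!∣n!)
open import Data.Nat.DivMod using (m/n*n≤m; m/n*n≡m; m≡m%n+[m/n]*n; m%n<n)
open import Data.Nat.Tactic.RingSolver using (solve-∀)
open import Data.Bool using (Bool; true; false; _∧_; if_then_else_; T)
open import Data.Bool.Properties using (T-∧; ∧-zeroʳ; ∧-assoc; ∧-identityʳ)
open import Data.List using (List; []; _∷_; _++_; map; concatMap; applyUpTo; length; filter)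
open import Data.Vec using (Vec; []; _∷_; lookup)
open import Data.Fin using (Fin; toℕ; zero; suc)
open import Data.Product using (_×_; _,_)
open import Data.Sum using (_⊎_; inj₁; inj₂)
open import Function.Bundles using (Equivalence; mk⇔)
open import Relation.Binary.PropositionalEquality hiding (J)
open import Relation.Nullary using (Dec; yes; no; does)
open import Relation.Nullary.Decidable using (does-⇔; dec-true; dec-false; T?)
open import Relation.Unary using (Decidable)
open ≡-Reasoning

open Equivalence using (to; from)

private variable
  A B : Set
  f g : ℕ → ℕ

∑ : ℕ → (ℕ → ℕ) → ℕ
∑ zero    f = 0
∑ (suc n) f = f 0 + ∑ n (λ i → f (suc i))

∑-cong< : ∀ n → (∀ i → i < n → f i ≡ g i) → ∑ n f ≡ ∑ n g
∑-cong< zero    eq = refl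
∑-cong< (suc n) eq = cong₂ _+_ (eq 0 z<s) (∑-cong< n (λ i i<n → eq (suc i) (s<s i<n)))

∑-cong : ∀ n → (∀ i → f i ≡ g i) → ∑ n f ≡ ∑ n g
∑-cong n eq = ∑-cong< n (λ i _ → eq i)

∑-zero : ∀ n → (∀ i → f i ≡ 0) → ∑ n f ≡ 0
∑-zero zero    eq = refl
∑-zero (suc n) eq = cong₂ _+_ (eq 0) (∑-zero n (λ i → eq (suc i)))

∑-mono-≤ : ∀ n → (∀ i → i < n → f i ≤ g i) → ∑ n f ≤ ∑ n g
∑-mono-≤ zero    le = z≤n
∑-mono-≤ (suc n) le = +-mono-≤ (le 0 z<s) (∑-mono-≤ n (λ i i<n → le (suc i) (s<s i<n)))

∑-snoc : ∀ n f → ∑ (suc n) f ≡ ∑ n f + f n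
∑-snoc zero    f = +-identityʳ (f 0)
∑-snoc (suc n) f = trans (cong (f 0 +_) (∑-snoc n (λ i → f (suc i)))) (sym (+-assoc (f 0) _ _))

∑-vanishing-tail : ∀ {m n} → m ≤ n → (∀ i → m ≤ i → f i ≡ 0) → ∑ n f ≡ ∑ m f
∑-vanishing-tail {n = n} z≤n       eq = ∑-zero n (λ i → eq i z≤n)
∑-vanishing-tail {f = f} (s≤s m≤n) eq = cong (f 0 +_) (∑-vanishing-tail m≤n (λ i m≤i → eq (suc i) (s≤s m≤i)))

∑-distrib-+ : ∀ n (f g : ℕ → ℕ) → ∑ n (λ i → f i + g i) ≡ ∑ n f + ∑ n g
∑-distrib-+ zero    f g = refl
∑-distrib-+ (suc n) f g =
  trans (cong (f 0 + g 0 +_) (∑-distrib-+ n (λ i → f (suc i)) (λ i → g (suc i))))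
        (+-interchange (f 0) (g 0) _ _)
  where
  +-interchange : ∀ a b c d → a + b + (c + d) ≡ a + c + (b + d)
  +-interchange = solve-∀

∑-distribˡ-* : ∀ n c (f : ℕ → ℕ) → c * ∑ n f ≡ ∑ n (λ i → c * f i)
∑-distribˡ-* zero    c f = *-zeroʳ c
∑-distribˡ-* (suc n) c f =
  trans (*-distribˡ-+ c (f 0) _) (cong (c * f 0 +_) (∑-distribˡ-* n c (λ i → f (suc i))))

∑-comm : ∀ m n (f : ℕ → ℕ → ℕ) → ∑ m (λ i → ∑ n (f i)) ≡ ∑ n (λ j → ∑ m (λ i → f i j))
∑-comm zero    n f = sym (∑-zero n (λ _ → refl))
∑-comm (suc m) n f =
  trans (cong (∑ n (f 0) +_) (∑-comm m n (λ i → f (suc i))))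
        (sym (∑-distrib-+ n (f 0) (λ j → ∑ m (λ i → f (suc i) j))))

conv : ℕ → (ℕ → ℕ → ℕ) → ℕ
conv J F = ∑ (suc J) (λ d → F d (J ∸ d))

conv-cong : ∀ J {F G : ℕ → ℕ → ℕ} → (∀ d u → d + u ≡ J → F d u ≡ G d u) → conv J F ≡ conv J G
conv-cong zero    eq = cong (_+ 0) (eq 0 0 refl)
conv-cong (suc J) eq = cong₂ _+_ (eq 0 (suc J) refl) (conv-cong J (λ d u e → eq (suc d) u (cong suc e)))

conv-snoc : ∀ J (F : ℕ → ℕ → ℕ) → conv (suc J) F ≡ conv J (λ d u → F d (suc u)) + F (suc J) 0
conv-snoc zero    F = trans (cong (F 0 1 +_) (+-identityʳ (F 1 0))) (cong (_+ F 1 0) (sym (+-identityʳ (F 0 1))))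
conv-snoc (suc J) F =
  trans (cong (F 0 (suc (suc J)) +_) (conv-snoc J (λ d → F (suc d)))) (sym (+-assoc (F 0 (suc (suc J))) _ _))

-- Pascal's recursion for n C k, which unfolds by pattern matching; see C≡choose.
infix 8 _choose_

_choose_ : ℕ → ℕ → ℕ
n     choose zero  = 1
zero  choose suc k = 0
suc n choose suc k = n choose k + n choose suc k

C≡choose : ∀ n k → n C k ≡ n choose k
C≡choose n       zero    = refl
C≡choose zero    (suc k) = k>n⇒nCk≡0 (z<s {k})
C≡choose (suc n) (suc k) =
  trans (sym (nCk+nC[k+1]≡[n+1]C[k+1] n k)) (cong₂ _+_ (C≡choose n k) (C≡choose n (suc k)))

choose-vanish : ∀ {n k} → n < k → n choose k ≡ 0
choose-vanish {zero}  {suc k} _         = refl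
choose-vanish {suc n} {suc k} (s<s n<k) = cong₂ _+_ (choose-vanish n<k) (choose-vanish (m<n⇒m<1+n n<k))

choose-sym : ∀ {n k} → k ≤ n → n choose k ≡ n choose (n ∸ k)
choose-sym {n} {k} k≤n = begin
  n choose k        ≡⟨ C≡choose n k ⟨
  n C k             ≡⟨ nCk≡nC[n∸k] k≤n ⟩
  n C (n ∸ k)       ≡⟨ C≡choose n (n ∸ k) ⟩
  n choose (n ∸ k)  ∎

choose-sym-+ : ∀ a b → (a + b) choose a ≡ (a + b) choose b
choose-sym-+ a b = trans (choose-sym (m≤m+n a b)) (cong ((a + b) choose_) (m+n∸m≡n a b))

choose*factorials : ∀ {n k} → k ≤ n → n choose k * (k ! * (n ∸ k) !) ≡ n !
choose*factorials {n} {k} k≤n = begin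
  n choose k * (k ! * (n ∸ k) !)               ≡⟨ cong (_* (k ! * (n ∸ k) !)) (C≡choose n k) ⟨
  (n C k) * (k ! * (n ∸ k) !)                  ≡⟨ cong (_* (k ! * (n ∸ k) !)) (nCk≡n!/k![n-k]! k≤n) ⟩
  n ! / (k ! * (n ∸ k) !) * (k ! * (n ∸ k) !)  ≡⟨ m/n*n≡m (k![n∸k]!∣n! k≤n) ⟩
  n !                                          ∎
  where instance _ = k !* (n ∸ k) !≢0

choose-+*factorials : ∀ a b → (a + b) choose a * (a ! * b !) ≡ (a + b) !
choose-+*factorials a b =
  subst (λ c → (a + b) choose a * (a ! * c !) ≡ (a + b) !) (m+n∸m≡n a b) (choose*factorials (m≤m+n a b))

-- Multiplied by a ! * (b ! * c !), both sides become (a + (b + c)) !.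
choose-blocks : ∀ a b c →
  (a + (b + c)) choose a * (b + c) choose b ≡ (a + (b + c)) choose (a + b) * (a + b) choose a
choose-blocks a b c =
  *-cancelʳ-≡ _ _ (a ! * (b ! * c !)) {{m*n≢0 (a !) (b ! * c !) {{a !≢0}} {{b !* c !≢0}}}}
    (trans left (sym right))
  where
  n : ℕ
  n = a + (b + c)
  left : n choose a * (b + c) choose b * (a ! * (b ! * c !)) ≡ n !
  left = begin
    n choose a * (b + c) choose b * (a ! * (b ! * c !))
      ≡⟨ shuffle (n choose a) ((b + c) choose b) (a !) (b !) (c !) ⟩
    n choose a * (a ! * ((b + c) choose b * (b ! * c !)))
      ≡⟨ cong (λ z → n choose a * (a ! * z)) (choose-+*factorials b c) ⟩
    n choose a * (a ! * (b + c) !)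
      ≡⟨ choose-+*factorials a (b + c) ⟩
    n ! ∎
    where
    shuffle : ∀ x y p q r → x * y * (p * (q * r)) ≡ x * (p * (y * (q * r)))
    shuffle = solve-∀
  right : n choose (a + b) * (a + b) choose a * (a ! * (b ! * c !)) ≡ n !
  right = begin
    n choose (a + b) * (a + b) choose a * (a ! * (b ! * c !))
      ≡⟨ shuffle (n choose (a + b)) ((a + b) choose a) (a !) (b !) (c !) ⟩
    n choose (a + b) * ((a + b) choose a * (a ! * b !) * c !)
      ≡⟨ cong (λ z → n choose (a + b) * (z * c !)) (choose-+*factorials a b) ⟩
    n choose (a + b) * ((a + b) ! * c !)
      ≡⟨ subst (λ m → m choose (a + b) * ((a + b) ! * c !) ≡ m !) (+-assoc a b c) (choose-+*factorials (a + b) c) ⟩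
    n ! ∎
    where
    shuffle : ∀ x y p q r → x * y * (p * (q * r)) ≡ x * (y * (p * q) * r)
    shuffle = solve-∀

choose-subset : ∀ n i c → n choose i * (n ∸ i) choose c ≡ n choose (i + c) * (i + c) choose i
choose-subset n i c with i + c ≤? n | i ≤? n
... | yes i+c≤n | _ = subst (λ m → m choose i * (m ∸ i) choose c ≡ m choose (i + c) * (i + c) choose i)
                        (trans (sym (+-assoc i c e)) (m+[n∸m]≡n i+c≤n))
                        (subst (λ m → (i + (c + e)) choose i * m choose c ≡ (i + (c + e)) choose (i + c) * (i + c) choose i)
                          (sym (m+n∸m≡n i (c + e))) (choose-blocks i c e))
  where
    e : ℕ
    e = n ∸ (i + c)
... | no i+c≰n | yes i≤n = begin
  n choose i * (n ∸ i) choose c   ≡⟨ cong (n choose i *_) (choose-vanish n∸i<c) ⟩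
  n choose i * 0                   ≡⟨ *-zeroʳ (n choose i) ⟩
  0                                ≡⟨ cong (_* (i + c) choose i) (choose-vanish (≰⇒> i+c≰n)) ⟨
  n choose (i + c) * (i + c) choose i ∎
  where
  n∸i<c : n ∸ i < c
  n∸i<c = +-cancelˡ-< i (n ∸ i) c (subst (_< i + c) (sym (m+[n∸m]≡n i≤n)) (≰⇒> i+c≰n))
... | no i+c≰n | no i≰n =
  trans (cong (_* (n ∸ i) choose c) (choose-vanish (≰⇒> i≰n)))
        (sym (cong (_* (i + c) choose i) (choose-vanish (≰⇒> i+c≰n))))

choose-subset-comm : ∀ n i c → n choose i * (n ∸ i) choose c ≡ n choose c * (n ∸ c) choose i
choose-subset-comm n i c = begin
  n choose i * (n ∸ i) choose c        ≡⟨ choose-subset n i c ⟩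
  n choose (i + c) * (i + c) choose i  ≡⟨ cong₂ (λ x y → n choose x * y) (+-comm i c) (choose-sym-+ i c) ⟩
  n choose (c + i) * (i + c) choose c  ≡⟨ cong (λ x → n choose (c + i) * x choose c) (+-comm i c) ⟩
  n choose (c + i) * (c + i) choose c  ≡⟨ choose-subset n c i ⟨
  n choose c * (n ∸ c) choose i        ∎

vandermonde : ∀ a b N → conv N (λ i u → a choose i * b choose u) ≡ (a + b) choose N
vandermonde zero    b zero    = refl
vandermonde zero    b (suc N) = trans (cong₂ _+_ (+-identityʳ _) (∑-zero (suc N) (λ _ → refl))) (+-identityʳ _)
vandermonde (suc a) b zero    = refl
vandermonde (suc a) b (suc N) = begin
  a′ choose 0 * b choose suc N + conv N (λ d u → a′ choose suc d * b choose u)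
    ≡⟨ cong (b choose suc N + 0 +_) pascal ⟩
  a choose 0 * b choose suc N + (conv N (λ d u → a choose d * b choose u) + conv N (λ d u → a choose suc d * b choose u))
    ≡⟨ +-comm-middle (a choose 0 * b choose suc N) (conv N (λ d u → a choose d * b choose u)) _ ⟩
  conv N (λ d u → a choose d * b choose u) + conv (suc N) (λ d u → a choose d * b choose u)
    ≡⟨ cong₂ _+_ (vandermonde a b N) (vandermonde a b (suc N)) ⟩
  (a + b) choose N + (a + b) choose suc N ∎
  where
  a′ : ℕ
  a′ = suc a
  pascal : conv N (λ d u → a′ choose suc d * b choose u)
         ≡ conv N (λ d u → a choose d * b choose u) + conv N (λ d u → a choose suc d * b choose u)
  pascal = trans (∑-cong (suc N) (λ d → *-distribʳ-+ (b choose (N ∸ d)) (a choose d) (a choose suc d)))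
                 (∑-distrib-+ (suc N) (λ d → a choose d * b choose (N ∸ d)) (λ d → a choose suc d * b choose (N ∸ d)))
  +-comm-middle : ∀ x y z → x + (y + z) ≡ y + (x + z)
  +-comm-middle = solve-∀

vandermonde-square : ∀ a j → ∑ (suc j) (λ i → a choose i * j choose i) ≡ (a + j) choose j
vandermonde-square a j =
  trans (∑-cong< (suc j) (λ i i≤j → cong (a choose i *_) (choose-sym (s≤s⁻¹ i≤j)))) (vandermonde a j j)

hockey-stick : ∀ s c → ∑ s (λ x → (s ∸ suc x) choose c) ≡ s choose suc c
hockey-stick zero    c = refl
hockey-stick (suc s) c = cong (s choose c +_) (hockey-stick s c)

choose-absorb : ∀ e r → suc r * e choose suc r + r * e choose r ≡ e * e choose r
choose-absorb zero    zero    = refl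
choose-absorb zero    (suc r) = cong₂ _+_ (*-zeroʳ (suc (suc r))) (*-zeroʳ (suc r))
choose-absorb (suc e) zero    = trans (+-identityʳ _) (trans (*-identityˡ _) (cong suc e-choose-1))
  where
  e-choose-1 : e choose 1 ≡ e * 1
  e-choose-1 = trans (sym (C≡choose e 1)) (trans (nC1≡n e) (sym (*-identityʳ e)))
choose-absorb (suc e) (suc r) = begin
  suc (suc r) * (x₁ + x₂) + suc r * (x₀ + x₁)
    ≡⟨ regroup r x₀ x₁ x₂ ⟩
  (suc (suc r) * x₂ + suc r * x₁) + ((suc r * x₁ + r * x₀) + x₁ + x₀)
    ≡⟨ cong₂ (λ a b → a + (b + x₁ + x₀)) (choose-absorb e (suc r)) (choose-absorb e r) ⟩
  e * x₁ + (e * x₀ + x₁ + x₀)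
    ≡⟨ collect e x₀ x₁ ⟩
  suc e * (x₀ + x₁) ∎
  where
  x₀ x₁ x₂ : ℕ
  x₀ = e choose r
  x₁ = e choose suc r
  x₂ = e choose suc (suc r)
  regroup : ∀ r x₀ x₁ x₂ → suc (suc r) * (x₁ + x₂) + suc r * (x₀ + x₁)
          ≡ (suc (suc r) * x₂ + suc r * x₁) + ((suc r * x₁ + r * x₀) + x₁ + x₀)
  regroup = solve-∀
  collect : ∀ e x₀ x₁ → e * x₁ + (e * x₀ + x₁ + x₀) ≡ suc e * (x₀ + x₁)
  collect = solve-∀

private
  double-plus-one : ∀ r x → suc r * x + r * x ≡ suc (r + r) * x
  double-plus-one = solve-∀

-- By choose-absorb, (r + 1) e choose (r + 1) − (r + 1) e choose r = (e − 2r − 1) e choose r.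
choose-increasing : ∀ e r → suc (r + r) ≤ e → e choose r ≤ e choose suc r
choose-increasing e r le = *-cancelˡ-≤ (suc r) (+-cancelʳ-≤ (r * e choose r) _ _
  (subst₂ _≤_ (sym (double-plus-one r (e choose r))) (sym (choose-absorb e r)) (*-monoˡ-≤ (e choose r) le)))

choose-decreasing : ∀ e r → e ≤ suc (r + r) → e choose suc r ≤ e choose r
choose-decreasing e r le = *-cancelˡ-≤ (suc r) (+-cancelʳ-≤ (r * e choose r) _ _
  (subst₂ _≤_ (sym (choose-absorb e r)) (sym (double-plus-one r (e choose r))) (*-monoˡ-≤ (e choose r) le)))

coeff-+ₚ : ∀ p q i → coeff (p +ₚ q) i ≡ coeff p i + coeff q i
coeff-+ₚ []      q       i       = refl
coeff-+ₚ (a ∷ p) []      i       = sym (+-identityʳ _)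
coeff-+ₚ (a ∷ p) (b ∷ q) zero    = refl
coeff-+ₚ (a ∷ p) (b ∷ q) (suc i) = coeff-+ₚ p q i

coeff-·ₚ : ∀ c p i → coeff (c ·ₚ p) i ≡ c * coeff p i
coeff-·ₚ c []      i       = sym (*-zeroʳ c)
coeff-·ₚ c (a ∷ p) zero    = refl
coeff-·ₚ c (a ∷ p) (suc i) = coeff-·ₚ c p i

coeff-∷-*ₚ : ∀ a p q j → coeff ((a ∷ p) *ₚ q) j ≡ a * coeff q j + coeff (0 ∷ (p *ₚ q)) j
coeff-∷-*ₚ a p q j = trans (coeff-+ₚ (a ·ₚ q) (0 ∷ (p *ₚ q)) j) (cong (_+ coeff (0 ∷ (p *ₚ q)) j) (coeff-·ₚ a q j))

coeff-*ₚ-zeroˡ : ∀ p q → (∀ i → coeff p i ≡ 0) → ∀ j → coeff (p *ₚ q) j ≡ 0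
coeff-*ₚ-zeroˡ []      q p≈0 j       = refl
coeff-*ₚ-zeroˡ (a ∷ p) q p≈0 zero    =
  trans (coeff-∷-*ₚ a p q 0) (trans (+-identityʳ _) (cong (_* coeff q 0) (p≈0 0)))
coeff-*ₚ-zeroˡ (a ∷ p) q p≈0 (suc j) =
  trans (coeff-∷-*ₚ a p q (suc j))
        (cong₂ _+_ (cong (_* coeff q (suc j)) (p≈0 0)) (coeff-*ₚ-zeroˡ p q (λ i → p≈0 (suc i)) j))

coeff-*ₚ-congˡ : ∀ p p′ q → (∀ i → coeff p i ≡ coeff p′ i) → ∀ j → coeff (p *ₚ q) j ≡ coeff (p′ *ₚ q) j
coeff-*ₚ-congˡ []      []       q p≈p′ j = refl
coeff-*ₚ-congˡ []      (b ∷ p′) q p≈p′ j = sym (coeff-*ₚ-zeroˡ (b ∷ p′) q (λ i → sym (p≈p′ i)) j)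
coeff-*ₚ-congˡ (a ∷ p) []       q p≈p′ j = coeff-*ₚ-zeroˡ (a ∷ p) q p≈p′ j
coeff-*ₚ-congˡ (a ∷ p) (b ∷ p′) q p≈p′ zero = begin
  coeff ((a ∷ p) *ₚ q) 0    ≡⟨ coeff-∷-*ₚ a p q 0 ⟩
  a * coeff q 0 + 0         ≡⟨ cong (λ z → z * coeff q 0 + 0) (p≈p′ 0) ⟩
  b * coeff q 0 + 0         ≡⟨ coeff-∷-*ₚ b p′ q 0 ⟨
  coeff ((b ∷ p′) *ₚ q) 0   ∎
coeff-*ₚ-congˡ (a ∷ p) (b ∷ p′) q p≈p′ (suc j) = begin
  coeff ((a ∷ p) *ₚ q) (suc j)                   ≡⟨ coeff-∷-*ₚ a p q (suc j) ⟩
  a * coeff q (suc j) + coeff (p *ₚ q) j         ≡⟨ cong₂ (λ z w → z * coeff q (suc j) + w) (p≈p′ 0)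
                                                      (coeff-*ₚ-congˡ p p′ q (λ i → p≈p′ (suc i)) j) ⟩
  b * coeff q (suc j) + coeff (p′ *ₚ q) j        ≡⟨ coeff-∷-*ₚ b p′ q (suc j) ⟨
  coeff ((b ∷ p′) *ₚ q) (suc j)                  ∎

coeff-oneₚ-*ₚ : ∀ q j → coeff (oneₚ *ₚ q) j ≡ coeff q j
coeff-oneₚ-*ₚ q zero    = trans (coeff-∷-*ₚ 1 [] q 0) (trans (+-identityʳ _) (*-identityˡ _))
coeff-oneₚ-*ₚ q (suc j) = trans (coeff-∷-*ₚ 1 [] q (suc j)) (trans (+-identityʳ _) (*-identityˡ _))

δ : ℕ → ℕ → ℕ
δ zero    zero    = 1
δ zero    (suc _) = 0
δ (suc _) zero    = 0
δ (suc i) (suc j) = δ i j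

-- The coefficients of tᶦ · p, in terms of those of p.
shift : ℕ → (ℕ → ℕ) → ℕ → ℕ
shift zero    f j       = f j
shift (suc i) f zero    = 0
shift (suc i) f (suc j) = shift i f j

shift-cong : ∀ i {f g : ℕ → ℕ} → (∀ a → f a ≡ g a) → ∀ j → shift i f j ≡ shift i g j
shift-cong zero    f≗g j       = f≗g j
shift-cong (suc i) f≗g zero    = refl
shift-cong (suc i) f≗g (suc j) = shift-cong i f≗g j

-- tᶦ written as the list 0 ∷ … ∷ 0 ∷ 1 ∷ [], whose product with q unfolds to a shift.
monomial : ℕ → Poly
monomial zero    = oneₚ
monomial (suc i) = 0 ∷ monomial i

coeff-monomial : ∀ i j → coeff (monomial i) j ≡ δ i j
coeff-monomial zero    zero    = refl
coeff-monomial zero    (suc j) = refl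
coeff-monomial (suc i) zero    = refl
coeff-monomial (suc i) (suc j) = coeff-monomial i j

coeff-monomial-*ₚ : ∀ i q j → coeff (monomial i *ₚ q) j ≡ shift i (coeff q) j
coeff-monomial-*ₚ zero    q j       = coeff-oneₚ-*ₚ q j
coeff-monomial-*ₚ (suc i) q zero    = coeff-∷-*ₚ 0 (monomial i) q 0
coeff-monomial-*ₚ (suc i) q (suc j) = trans (coeff-∷-*ₚ 0 (monomial i) q (suc j)) (coeff-monomial-*ₚ i q j)

coeff-tₚ^ₚ : ∀ i j → coeff (tₚ ^ₚ i) j ≡ δ i j
coeff-tₚ^ₚ zero    zero    = refl
coeff-tₚ^ₚ zero    (suc j) = refl
coeff-tₚ^ₚ (suc i) zero    = coeff-∷-*ₚ 0 (1 ∷ []) (tₚ ^ₚ i) 0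
coeff-tₚ^ₚ (suc i) (suc j) =
  trans (coeff-∷-*ₚ 0 (1 ∷ []) (tₚ ^ₚ i) (suc j)) (trans (coeff-oneₚ-*ₚ (tₚ ^ₚ i) j) (coeff-tₚ^ₚ i j))

coeff-tₚ^ₚ-*ₚ : ∀ i q j → coeff ((tₚ ^ₚ i) *ₚ q) j ≡ shift i (coeff q) j
coeff-tₚ^ₚ-*ₚ i q j =
  trans (coeff-*ₚ-congˡ (tₚ ^ₚ i) (monomial i) q (λ a → trans (coeff-tₚ^ₚ i a) (sym (coeff-monomial i a))) j)
        (coeff-monomial-*ₚ i q j)

coeff-[1+t]^ₚ : ∀ e j → coeff ((oneₚ +ₚ tₚ) ^ₚ e) j ≡ e choose j
coeff-[1+t]^ₚ zero    zero    = refl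
coeff-[1+t]^ₚ zero    (suc j) = refl
coeff-[1+t]^ₚ (suc e) zero    =
  trans (coeff-∷-*ₚ 1 (1 ∷ []) ((oneₚ +ₚ tₚ) ^ₚ e) 0)
        (trans (+-identityʳ _) (trans (*-identityˡ _) (coeff-[1+t]^ₚ e 0)))
coeff-[1+t]^ₚ (suc e) (suc j) = begin
  coeff ((oneₚ +ₚ tₚ) *ₚ p) (suc j)               ≡⟨ coeff-∷-*ₚ 1 (1 ∷ []) p (suc j) ⟩
  1 * coeff p (suc j) + coeff (oneₚ *ₚ p) j        ≡⟨ cong₂ _+_ (*-identityˡ _) (coeff-oneₚ-*ₚ p j) ⟩
  coeff p (suc j) + coeff p j                      ≡⟨ cong₂ _+_ (coeff-[1+t]^ₚ e (suc j)) (coeff-[1+t]^ₚ e j) ⟩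
  e choose suc j + e choose j                      ≡⟨ +-comm (e choose suc j) (e choose j) ⟩
  suc e choose suc j                               ∎
  where
    p : Poly
    p = (oneₚ +ₚ tₚ) ^ₚ e

coeff-sumₚ : ∀ n f j → coeff (sumₚ n f) j ≡ ∑ (suc n) (λ i → coeff (f i) j)
coeff-sumₚ zero    f j = sym (+-identityʳ _)
coeff-sumₚ (suc n) f j = begin
  coeff (sumₚ n f +ₚ f (suc n)) j                        ≡⟨ coeff-+ₚ (sumₚ n f) (f (suc n)) j ⟩
  coeff (sumₚ n f) j + coeff (f (suc n)) j               ≡⟨ cong (_+ coeff (f (suc n)) j) (coeff-sumₚ n f j) ⟩
  ∑ (suc n) (λ i → coeff (f i) j) + coeff (f (suc n)) j  ≡⟨ ∑-snoc (suc n) (λ i → coeff (f i) j) ⟨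
  ∑ (suc (suc n)) (λ i → coeff (f i) j)                  ∎

∑-δ : ∀ n (h : ℕ → ℕ) j → j < n → ∑ n (λ i → h i * δ i j) ≡ h j
∑-δ (suc n) h zero    _ =
  trans (cong₂ _+_ (*-identityʳ (h 0)) (∑-zero n (λ i → *-zeroʳ (h (suc i))))) (+-identityʳ _)
∑-δ (suc n) h (suc j) (s<s j<n) = cong₂ _+_ (*-zeroʳ (h 0)) (∑-δ n (λ i → h (suc i)) j j<n)

∑-δ-out : ∀ n (h : ℕ → ℕ) j → n ≤ j → ∑ n (λ i → h i * δ i j) ≡ 0
∑-δ-out zero    h j       _         = refl
∑-δ-out (suc n) h (suc j) (s≤s n≤j) = cong₂ _+_ (*-zeroʳ (h 0)) (∑-δ-out n (λ i → h (suc i)) j n≤j)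

coeff-sumₚ-monomials : ∀ n (h : ℕ → ℕ) j →
  coeff (sumₚ n (λ i → h i ·ₚ (tₚ ^ₚ i))) j ≡ ∑ (suc n) (λ i → h i * δ i j)
coeff-sumₚ-monomials n h j = trans (coeff-sumₚ n (λ i → h i ·ₚ (tₚ ^ₚ i)) j)
  (∑-cong (suc n) (λ i → trans (coeff-·ₚ (h i) (tₚ ^ₚ i) j) (cong (h i *_) (coeff-tₚ^ₚ i j))))

γ-expansion : (ℕ → ℕ) → ℕ → Poly
γ-expansion γ n = sumₚ (n / 2) (λ i → γ i ·ₚ ((tₚ ^ₚ i) *ₚ ((oneₚ +ₚ tₚ) ^ₚ (n ∸ 2 * i))))

γ-coeff : (ℕ → ℕ) → ℕ → ℕ → ℕ
γ-coeff γ n j = ∑ (suc (n / 2)) (λ i → γ i * shift i ((n ∸ 2 * i) choose_) j)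

coeff-γ-expansion : ∀ γ n j → coeff (γ-expansion γ n) j ≡ γ-coeff γ n j
coeff-γ-expansion γ n j = trans (coeff-sumₚ (n / 2) _ j) (∑-cong (suc (n / 2)) (λ i → begin
  coeff (γ i ·ₚ ((tₚ ^ₚ i) *ₚ (oneₚ +ₚ tₚ) ^ₚ (n ∸ 2 * i))) j
    ≡⟨ coeff-·ₚ (γ i) ((tₚ ^ₚ i) *ₚ (oneₚ +ₚ tₚ) ^ₚ (n ∸ 2 * i)) j ⟩
  γ i * coeff ((tₚ ^ₚ i) *ₚ (oneₚ +ₚ tₚ) ^ₚ (n ∸ 2 * i)) j
    ≡⟨ cong (γ i *_) (coeff-tₚ^ₚ-*ₚ i _ j) ⟩
  γ i * shift i (coeff ((oneₚ +ₚ tₚ) ^ₚ (n ∸ 2 * i))) j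
    ≡⟨ cong (γ i *_) (shift-cong i (coeff-[1+t]^ₚ (n ∸ 2 * i)) j) ⟩
  γ i * shift i ((n ∸ 2 * i) choose_) j ∎))

shift-≤ : ∀ i (f : ℕ → ℕ) j → i ≤ j → shift i f j ≡ f (j ∸ i)
shift-≤ zero    f j       _         = refl
shift-≤ (suc i) f (suc j) (s≤s i≤j) = shift-≤ i f j i≤j

shift-> : ∀ i (f : ℕ → ℕ) j → j < i → shift i f j ≡ 0
shift-> (suc i) f zero    _         = refl
shift-> (suc i) f (suc j) (s<s j<i) = shift-> i f j j<i

shift-choose-vanish : ∀ a e i → a + e < i → shift a (e choose_) i ≡ 0
shift-choose-vanish zero    e i       lt        = choose-vanish lt
shift-choose-vanish (suc a) e (suc i) (s<s lt) = shift-choose-vanish a e i lt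

shift-choose-sym : ∀ a e i i′ → i + i′ ≡ a + (a + e) → shift a (e choose_) i ≡ shift a (e choose_) i′
shift-choose-sym zero    e i       i′       eq = subst (λ z → z choose i ≡ z choose i′) eq (choose-sym-+ i i′)
shift-choose-sym (suc a) e zero    i′       eq =
  sym (shift-choose-vanish (suc a) e i′ (subst (suc a + e <_) (sym eq) (+-monoʳ-< (suc a) (m<n+m e z<s))))
shift-choose-sym (suc a) e (suc i) zero     eq =
  shift-choose-vanish (suc a) e (suc i)
    (subst (suc a + e <_) (trans (sym eq) (+-identityʳ (suc i))) (+-monoʳ-< (suc a) (m<n+m e z<s)))
shift-choose-sym (suc a) e (suc i) (suc i′) eq =
  shift-choose-sym a e i i′ (suc-injective (trans (sym (+-suc i i′)) (trans (suc-injective eq) (+-suc a (a + e)))))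

shift-choose-increasing : ∀ a e j → suc (j + j) ≤ a + (a + e) → shift a (e choose_) j ≤ shift a (e choose_) (suc j)
shift-choose-increasing zero    e j       le = choose-increasing e j le
shift-choose-increasing (suc a) e zero    le = z≤n
shift-choose-increasing (suc a) e (suc j) le rewrite +-suc j j | +-suc a (a + e) =
  shift-choose-increasing a e j (s≤s⁻¹ (s≤s⁻¹ le))

shift-choose-decreasing : ∀ a e j → a + (a + e) ≤ suc (j + j) → shift a (e choose_) (suc j) ≤ shift a (e choose_) j
shift-choose-decreasing zero    e j       le = choose-decreasing e j le
shift-choose-decreasing (suc a) e zero    le rewrite +-suc a (a + e) with () ← s≤s⁻¹ le
shift-choose-decreasing (suc a) e (suc j) le rewrite +-suc j j | +-suc a (a + e) =
  shift-choose-decreasing a e j (s≤s⁻¹ (s≤s⁻¹ le))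

2*[n/2]≤n : ∀ n → 2 * (n / 2) ≤ n
2*[n/2]≤n n = subst (_≤ n) (*-comm (n / 2) 2) (m/n*n≤m n 2)

n≤1+2*[n/2] : ∀ n → n ≤ suc (2 * (n / 2))
n≤1+2*[n/2] n = subst₂ _≤_ (sym (m≡m%n+[m/n]*n n 2)) (cong suc (*-comm (n / 2) 2))
  (+-monoˡ-≤ (n / 2 * 2) (s≤s⁻¹ (m%n<n n 2)))

private
  2*m≡m+m : ∀ m → 2 * m ≡ m + m
  2*m≡m+m = solve-∀

i≤n/2⇒i+i≤n : ∀ n i → i ≤ n / 2 → i + i ≤ n
i≤n/2⇒i+i≤n n i i≤n/2 = subst (_≤ n) (2*m≡m+m i) (≤-trans (*-monoʳ-≤ 2 i≤n/2) (2*[n/2]≤n n))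

n/2≤i⇒n≤1+i+i : ∀ n i → n / 2 ≤ i → n ≤ suc (i + i)
n/2≤i⇒n≤1+i+i n i n/2≤i = ≤-trans (n≤1+2*[n/2] n) (s≤s (subst (2 * (n / 2) ≤_) (2*m≡m+m i) (*-monoʳ-≤ 2 n/2≤i)))

i≤n/2⇒i+[i+[n∸2i]]≡n : ∀ n i → i ≤ n / 2 → i + (i + (n ∸ 2 * i)) ≡ n
i≤n/2⇒i+[i+[n∸2i]]≡n n i i≤n/2 = begin
  i + (i + (n ∸ 2 * i))  ≡⟨ +-assoc i i _ ⟨
  i + i + (n ∸ 2 * i)    ≡⟨ cong (_+ (n ∸ 2 * i)) (2*m≡m+m i) ⟨
  2 * i + (n ∸ 2 * i)    ≡⟨ m+[n∸m]≡n (subst (_≤ n) (sym (2*m≡m+m i)) (i≤n/2⇒i+i≤n n i i≤n/2)) ⟩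
  n                      ∎

γ-coeff-palindromic : ∀ γ n i → i ≤ n → γ-coeff γ n i ≡ γ-coeff γ n (n ∸ i)
γ-coeff-palindromic γ n i i≤n = ∑-cong< (suc (n / 2)) (λ a a<1+n/2 → cong (γ a *_)
  (shift-choose-sym a (n ∸ 2 * a) i (n ∸ i)
    (trans (m+[n∸m]≡n i≤n) (sym (i≤n/2⇒i+[i+[n∸2i]]≡n n a (s≤s⁻¹ a<1+n/2))))))

γ-coeff-increasing : ∀ γ n j → j < n / 2 → γ-coeff γ n j ≤ γ-coeff γ n (suc j)
γ-coeff-increasing γ n j j<n/2 = ∑-mono-≤ (suc (n / 2)) (λ a a<1+n/2 → *-monoʳ-≤ (γ a)
  (shift-choose-increasing a (n ∸ 2 * a) j
    (subst (suc (j + j) ≤_) (sym (i≤n/2⇒i+[i+[n∸2i]]≡n n a (s≤s⁻¹ a<1+n/2))) 1+2j≤n)))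
  where
  1+2j≤n : suc (j + j) ≤ n
  1+2j≤n = ≤-trans (s≤s (+-monoʳ-≤ j (n≤1+n j))) (i≤n/2⇒i+i≤n n (suc j) j<n/2)

γ-coeff-decreasing : ∀ γ n j → n / 2 ≤ j → γ-coeff γ n (suc j) ≤ γ-coeff γ n j
γ-coeff-decreasing γ n j n/2≤j = ∑-mono-≤ (suc (n / 2)) (λ a a<1+n/2 → *-monoʳ-≤ (γ a)
  (shift-choose-decreasing a (n ∸ 2 * a) j
    (subst (_≤ suc (j + j)) (sym (i≤n/2⇒i+[i+[n∸2i]]≡n n a (s≤s⁻¹ a<1+n/2))) (n/2≤i⇒n≤1+i+i n j n/2≤j))))

γ-positive⇒palindromic : ∀ n p → GammaPositive n p → Palindromic n p
γ-positive⇒palindromic n p (γ , p≈γ) i i≤n = begin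
  coeff p i                ≡⟨ trans (p≈γ i) (coeff-γ-expansion γ n i) ⟩
  γ-coeff γ n i            ≡⟨ γ-coeff-palindromic γ n i i≤n ⟩
  γ-coeff γ n (n ∸ i)      ≡⟨ trans (p≈γ (n ∸ i)) (coeff-γ-expansion γ n (n ∸ i)) ⟨
  coeff p (n ∸ i)          ∎

γ-positive⇒unimodal : ∀ n p → GammaPositive n p → Unimodal p
γ-positive⇒unimodal n p (γ , p≈γ) = n / 2 , increasing , decreasing
  where
  p≡γ-coeff : ∀ j → coeff p j ≡ γ-coeff γ n j
  p≡γ-coeff j = trans (p≈γ j) (coeff-γ-expansion γ n j)
  increasing : ∀ j → j < n / 2 → coeff p j ≤ coeff p (suc j)
  increasing j j<n/2 = subst₂ _≤_ (sym (p≡γ-coeff j)) (sym (p≡γ-coeff (suc j))) (γ-coeff-increasing γ n j j<n/2)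
  decreasing : ∀ j → n / 2 ≤ j → coeff p (suc j) ≤ coeff p j
  decreasing j n/2≤j = subst₂ _≤_ (sym (p≡γ-coeff (suc j))) (sym (p≡γ-coeff j)) (γ-coeff-decreasing γ n j n/2≤j)

count : (A → Bool) → List A → ℕ
count P []       = 0
count P (x ∷ xs) = (if P x then 1 else 0) + count P xs

count-cong : ∀ {P Q : A → Bool} xs → (∀ x → P x ≡ Q x) → count P xs ≡ count Q xs
count-cong []       P≗Q = refl
count-cong (x ∷ xs) P≗Q = cong₂ (λ b n → (if b then 1 else 0) + n) (P≗Q x) (count-cong xs P≗Q)

count-false : ∀ (xs : List A) → count (λ _ → false) xs ≡ 0
count-false []       = refl
count-false (x ∷ xs) = count-false xs

count-++ : ∀ (P : A → Bool) xs ys → count P (xs ++ ys) ≡ count P xs + count P ys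
count-++ P []       ys = refl
count-++ P (x ∷ xs) ys = trans (cong (_ +_) (count-++ P xs ys)) (sym (+-assoc (if P x then 1 else 0) _ _))

count-map : ∀ (P : B → Bool) (f : A → B) xs → count P (map f xs) ≡ count (λ x → P (f x)) xs
count-map P f []       = refl
count-map P f (x ∷ xs) = cong (_ +_) (count-map P f xs)

count-concatMap-applyUpTo : ∀ (P : B → Bool) (g : ℕ → List B) (h : ℕ → ℕ) n →
  count P (concatMap g (applyUpTo h n)) ≡ ∑ n (λ x → count P (g (h x)))
count-concatMap-applyUpTo P g h zero    = refl
count-concatMap-applyUpTo P g h (suc n) =
  trans (count-++ P (g (h 0)) (concatMap g (applyUpTo (λ x → h (suc x)) n)))
        (cong (count P (g (h 0)) +_) (count-concatMap-applyUpTo P g (λ x → h (suc x)) n))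

count-filter : ∀ {P : A → Set} (P? : Decidable P) (Q : A → Bool) xs →
  count Q (filter P? xs) ≡ count (λ x → does (P? x) ∧ Q x) xs
count-filter P? Q []       = refl
count-filter P? Q (x ∷ xs) with does (P? x)
... | true  = cong (_ +_) (count-filter P? Q xs)
... | false = count-filter P? Q xs

length≡count-true : ∀ (xs : List A) → length xs ≡ count (λ _ → true) xs
length≡count-true []       = refl
length≡count-true (x ∷ xs) = cong suc (length≡count-true xs)

count-∧ˡ : ∀ b (P : A → Bool) xs → count (λ x → b ∧ P x) xs ≡ (if b then count P xs else 0)
count-∧ˡ true  P xs = refl
count-∧ˡ false P xs = count-false xs

-- InQ n k is InQ≤ k n; the bound s on the coordinate sum shrinks as coordinates are split off.
InQ≤ : ∀ {n} → ℕ → ℕ → Vec ℕ n → Set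
InQ≤ {n} k s x = (∀ (j : Fin n) → toℕ j < k → lookup x j ≤ 1) × (vsum x ≤ s)

boundᵇ : ℕ → ℕ → Bool
boundᵇ zero    x = true
boundᵇ (suc k) x = x ≤ᵇ 1

inQᵇ : ∀ {n} → ℕ → ℕ → Vec ℕ n → Bool
inQᵇ k s []      = true
inQᵇ k s (x ∷ v) = boundᵇ k x ∧ ((x ≤ᵇ s) ∧ inQᵇ (pred k) (s ∸ x) v)

inQᵇ-sound : ∀ {n} k s (x : Vec ℕ n) → T (inQᵇ k s x) → InQ≤ k s x
inQᵇ-sound k s []      _ = (λ ()) , z≤n
inQᵇ-sound k s (x ∷ v) h with to T-∧ h
... | bounded , h′ with to T-∧ h′
... | x≤s , rest with inQᵇ-sound (pred k) (s ∸ x) v rest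
... | v-bounded , v-sum = x∷v-bounded k bounded v-bounded ,
  subst (x + vsum v ≤_) (m+[n∸m]≡n (≤ᵇ⇒≤ x s x≤s)) (+-monoʳ-≤ x v-sum)
  where
  x∷v-bounded : ∀ k → T (boundᵇ k x) → (∀ j → toℕ j < pred k → lookup v j ≤ 1) →
                ∀ j → toℕ j < k → lookup (x ∷ v) j ≤ 1
  x∷v-bounded (suc k) x≤1 _ zero    _   = ≤ᵇ⇒≤ x 1 x≤1
  x∷v-bounded (suc k) _   f (suc j) j<k = f j (s<s⁻¹ j<k)

inQᵇ-complete : ∀ {n} k s (x : Vec ℕ n) → InQ≤ k s x → T (inQᵇ k s x)
inQᵇ-complete k s []      _                 = _
inQᵇ-complete k s (x ∷ v) (bounded , x+v≤s) =
  from T-∧ (head-bounded k bounded , from T-∧ (≤⇒≤ᵇ (m+n≤o⇒m≤o x x+v≤s) ,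
    inQᵇ-complete (pred k) (s ∸ x) v
      (tail-bounded k bounded , m+n≤o⇒m≤o∸n (vsum v) (subst (_≤ s) (+-comm x (vsum v)) x+v≤s))))
  where
  head-bounded : ∀ k → (∀ j → toℕ j < k → lookup (x ∷ v) j ≤ 1) → T (boundᵇ k x)
  head-bounded zero    _ = _
  head-bounded (suc k) f = ≤⇒≤ᵇ (f zero z<s)
  tail-bounded : ∀ k → (∀ j → toℕ j < k → lookup (x ∷ v) j ≤ 1) → ∀ j → toℕ j < pred k → lookup v j ≤ 1
  tail-bounded zero    f j ()
  tail-bounded (suc k) f j j<k = f (suc j) (s<s j<k)

does-inQ? : ∀ n k (x : Vec ℕ n) → does (inQ? n k x) ≡ inQᵇ k n x
does-inQ? n k x = does-⇔ (mk⇔ (inQᵇ-complete k n x) (inQᵇ-sound k n x)) (inQ? n k x) (T? (inQᵇ k n x))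

latticeCount : (n b k s j : ℕ) → ℕ
latticeCount n b k s j = count (λ x → inQᵇ k s x ∧ (nonzeros x ≡ᵇ j)) (boxVecs n b)

hcoeff≡latticeCount : ∀ n k j → hcoeff n k j ≡ latticeCount n n k n j
hcoeff≡latticeCount n k j = begin
  length (filter (λ x → nonzeros x ≟ j) (filter (inQ? n k) box))
    ≡⟨ length≡count-true (filter (λ x → nonzeros x ≟ j) (filter (inQ? n k) box)) ⟩
  count (λ _ → true) (filter (λ x → nonzeros x ≟ j) (filter (inQ? n k) box))
    ≡⟨ count-filter (λ x → nonzeros x ≟ j) (λ _ → true) (filter (inQ? n k) box) ⟩
  count (λ x → does (nonzeros x ≟ j) ∧ true) (filter (inQ? n k) box)
    ≡⟨ count-filter (inQ? n k) (λ x → does (nonzeros x ≟ j) ∧ true) box ⟩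
  count (λ x → does (inQ? n k x) ∧ (does (nonzeros x ≟ j) ∧ true)) box
    ≡⟨ count-cong box (λ x → cong₂ _∧_ (does-inQ? n k x) (∧-identityʳ _)) ⟩
  latticeCount n n k n j ∎
  where
    box : List (Vec ℕ n)
    box = boxVecs n n

latticeCount-suc : ∀ n b k s j → latticeCount (suc n) b k s j
  ≡ ∑ (suc b) (λ x → count (λ v → inQᵇ k s (x ∷ v) ∧ (nonzeros (x ∷ v) ≡ᵇ j)) (boxVecs n b))
latticeCount-suc n b k s j =
  trans (count-concatMap-applyUpTo P (λ x → map (x ∷_) (boxVecs n b)) (λ x → x) (suc b))
        (∑-cong (suc b) (λ x → count-map P (x ∷_) (boxVecs n b)))
  where
  P : Vec ℕ (suc n) → Bool
  P v = inQᵇ k s v ∧ (nonzeros v ≡ᵇ j)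

latticeCount-suc-zero : ∀ n b k s → latticeCount (suc n) b k s 0 ≡ latticeCount n b (pred k) s 0
latticeCount-suc-zero n b k s =
  trans (latticeCount-suc n b k s 0)
        (trans (cong₂ _+_ (first-zero k) (∑-zero b (λ x → trans (count-cong (boxVecs n b) (λ v → ∧-zeroʳ _))
                                                                   (count-false (boxVecs n b)))))
               (+-identityʳ _))
  where
  first-zero : ∀ k → count (λ v → inQᵇ k s (0 ∷ v) ∧ (nonzeros v ≡ᵇ 0)) (boxVecs n b) ≡ latticeCount n b (pred k) s 0
  first-zero zero    = refl
  first-zero (suc k) = refl

-- A coordinate bounded by 1 is either 0 (leaving the budget s) or 1 (using up one unit of it).
latticeCount-binary : ∀ n b k s j → latticeCount (suc n) (suc b) (suc k) (suc s) (suc j)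
  ≡ latticeCount n (suc b) k (suc s) (suc j) + latticeCount n (suc b) k s j
latticeCount-binary n b k s j =
  trans (latticeCount-suc n (suc b) (suc k) (suc s) (suc j))
        (cong (latticeCount n (suc b) k (suc s) (suc j) +_)
          (trans (cong (latticeCount n (suc b) k s j +_) (∑-zero b (λ x → count-false (boxVecs n (suc b)))))
                 (+-identityʳ _)))

latticeCount-free : ∀ n b s j → latticeCount (suc n) b 0 s (suc j)
  ≡ latticeCount n b 0 s (suc j) + ∑ b (λ x → if suc x ≤ᵇ s then latticeCount n b 0 (s ∸ suc x) j else 0)
latticeCount-free n b s j =
  trans (latticeCount-suc n b 0 s (suc j))
        (cong (latticeCount n b 0 s (suc j) +_) (∑-cong b (λ x →
          trans (count-cong (boxVecs n b) (λ v → ∧-assoc (suc x ≤ᵇ s) _ _))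
                (count-∧ˡ (suc x ≤ᵇ s) _ (boxVecs n b)))))

-- Choose the j nonzero positions, then a composition of some number ≤ s into j positive parts.
latticeCount-free-closed : ∀ n b s j → s ≤ b → latticeCount n b 0 s j ≡ n choose j * s choose j
latticeCount-free-closed zero    b s zero    s≤b = refl
latticeCount-free-closed zero    b s (suc j) s≤b = refl
latticeCount-free-closed (suc n) b s zero    s≤b =
  trans (latticeCount-suc-zero n b 0 s) (latticeCount-free-closed n b s 0 s≤b)
latticeCount-free-closed (suc n) b s (suc j) s≤b = begin
  latticeCount (suc n) b 0 s (suc j)
    ≡⟨ latticeCount-free n b s j ⟩
  latticeCount n b 0 s (suc j) + ∑ b first-positive
    ≡⟨ cong₂ _+_ (latticeCount-free-closed n b s (suc j) s≤b)
                 (∑-vanishing-tail s≤b (λ x s≤x → cong (λ c → if c then rest x else 0) (dec-false (suc x ≤? s) (<⇒≱ (s≤s s≤x))))) ⟩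
  n choose suc j * s choose suc j + ∑ s first-positive
    ≡⟨ cong (n choose suc j * s choose suc j +_) (∑-cong< s (λ x x<s →
         trans (cong (λ c → if c then rest x else 0) (dec-true (suc x ≤? s) x<s))
               (latticeCount-free-closed n b (s ∸ suc x) j (≤-trans (m∸n≤m s (suc x)) s≤b)))) ⟩
  n choose suc j * s choose suc j + ∑ s (λ x → n choose j * (s ∸ suc x) choose j)
    ≡⟨ cong (n choose suc j * s choose suc j +_)
         (trans (sym (∑-distribˡ-* s (n choose j) (λ x → (s ∸ suc x) choose j))) (cong (n choose j *_) (hockey-stick s j))) ⟩
  n choose suc j * s choose suc j + n choose j * s choose suc j
    ≡⟨ trans (+-comm (n choose suc j * s choose suc j) _) (sym (*-distribʳ-+ (s choose suc j) (n choose j) (n choose suc j))) ⟩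
  suc n choose suc j * s choose suc j ∎
  where
  rest first-positive : ℕ → ℕ
  rest x = latticeCount n b 0 (s ∸ suc x) j
  first-positive x = if suc x ≤ᵇ s then rest x else 0

latticeSum : ℕ → ℕ → ℕ → ℕ → ℕ
latticeSum k m r j = conv j (λ d u → k choose d * r choose u * (m + d) choose j)

latticeSum-zero : ∀ m r j → latticeSum 0 m r j ≡ m choose j * r choose j
latticeSum-zero m r zero    = refl
latticeSum-zero m r (suc j) = begin
  1 * r choose suc j * (m + 0) choose suc j + ∑ (suc j) (λ _ → 0)
    ≡⟨ cong₂ _+_ (cong (λ z → 1 * r choose suc j * z choose suc j) (+-identityʳ m)) (∑-zero (suc j) (λ _ → refl)) ⟩
  1 * r choose suc j * m choose suc j + 0
    ≡⟨ trans (+-identityʳ _) (trans (cong (_* m choose suc j) (*-identityˡ (r choose suc j))) (*-comm (r choose suc j) _)) ⟩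
  m choose suc j * r choose suc j ∎

latticeSum-pascalʳ : ∀ k m r j → latticeSum k m (suc r) (suc j)
  ≡ conv j (λ d u → k choose d * r choose u * (m + d) choose suc j) + latticeSum k m r (suc j)
latticeSum-pascalʳ k m r j = begin
  latticeSum k m (suc r) J
    ≡⟨ conv-snoc j (λ d u → k choose d * suc r choose u * (m + d) choose J) ⟩
  conv j (λ d u → k choose d * (r choose u + r choose suc u) * (m + d) choose J) + F J 0
    ≡⟨ cong (_+ F J 0) (trans (∑-cong (suc j) (λ d → distrib (k choose d) (r choose (j ∸ d)) (r choose suc (j ∸ d)) ((m + d) choose J)))
                              (∑-distrib-+ (suc j) (λ d → F d (j ∸ d)) (λ d → F d (suc (j ∸ d))))) ⟩
  conv j F + conv j (λ d u → F d (suc u)) + F J 0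
    ≡⟨ +-assoc (conv j F) _ (F J 0) ⟩
  conv j F + (conv j (λ d u → F d (suc u)) + F J 0)
    ≡⟨ cong (conv j F +_) (conv-snoc j F) ⟨
  conv j F + latticeSum k m r J ∎
  where
  J : ℕ
  J = suc j
  F : ℕ → ℕ → ℕ
  F d u = k choose d * r choose u * (m + d) choose J
  distrib : ∀ a b c x → a * (b + c) * x ≡ a * b * x + a * c * x
  distrib = solve-∀

latticeSum-pascal-upper : ∀ k m r j →
  conv j (λ d u → k choose d * r choose u * (m + d) choose suc j) + latticeSum k m r j
  ≡ conv j (λ d u → k choose d * r choose u * (m + suc d) choose suc j)
latticeSum-pascal-upper k m r j =
  trans (sym (∑-distrib-+ (suc j) (λ d → F d (j ∸ d)) (λ d → H d (j ∸ d))))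
    (conv-cong j (λ d u _ → begin
      F d u + H d u
        ≡⟨ *-distribˡ-+ (k choose d * r choose u) ((m + d) choose suc j) ((m + d) choose j) ⟨
      k choose d * r choose u * ((m + d) choose suc j + (m + d) choose j)
        ≡⟨ cong (k choose d * r choose u *_) (+-comm ((m + d) choose suc j) _) ⟩
      k choose d * r choose u * suc (m + d) choose suc j
        ≡⟨ cong (λ z → k choose d * r choose u * z choose suc j) (+-suc m d) ⟨
      k choose d * r choose u * (m + suc d) choose suc j ∎))
  where
  F H : ℕ → ℕ → ℕ
  F d u = k choose d * r choose u * (m + d) choose suc j
  H d u = k choose d * r choose u * (m + d) choose j

latticeSum-pascal : ∀ k m r j → latticeSum (suc k) m r (suc j) ≡ latticeSum k m (suc r) (suc j) + latticeSum k m r j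
latticeSum-pascal k m r j = begin
  latticeSum (suc k) m r J
    ≡⟨ cong (F 0 J +_) (trans (conv-cong j (λ d u _ → split (k choose d) (k choose suc d) (r choose u) ((m + suc d) choose J)))
                              (∑-distrib-+ (suc j) (λ d → F (suc d) (j ∸ d)) (λ d → G d (j ∸ d)))) ⟩
  F 0 J + (conv j (λ d → F (suc d)) + conv j G)
    ≡⟨ +-assoc (F 0 J) _ (conv j G) ⟨
  latticeSum k m r J + conv j G
    ≡⟨ cong (latticeSum k m r J +_) (latticeSum-pascal-upper k m r j) ⟨
  latticeSum k m r J + (conv j F + latticeSum k m r j)
    ≡⟨ +-assoc (latticeSum k m r J) (conv j F) _ ⟨
  latticeSum k m r J + conv j F + latticeSum k m r j
    ≡⟨ cong (_+ latticeSum k m r j) (trans (+-comm (latticeSum k m r J) (conv j F)) (sym (latticeSum-pascalʳ k m r j))) ⟩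
  latticeSum k m (suc r) J + latticeSum k m r j ∎
  where
  J : ℕ
  J = suc j
  F G : ℕ → ℕ → ℕ
  F d u = k choose d * r choose u * (m + d) choose J
  G d u = k choose d * r choose u * (m + suc d) choose J
  split : ∀ a b c x → (a + b) * c * x ≡ b * c * x + a * c * x
  split = solve-∀

-- The budget is written k + r so that a coordinate equal to 1 never makes it truncate.
latticeCount≡latticeSum : ∀ k m r j b → k + r ≤ b → latticeCount (k + m) b k (k + r) j ≡ latticeSum k m r j
latticeCount≡latticeSum zero    m r j       b       r≤b = trans (latticeCount-free-closed m b r j r≤b) (sym (latticeSum-zero m r j))
latticeCount≡latticeSum (suc k) m r zero    b       k+r<b = begin
  latticeCount (suc (k + m)) b (suc k) (suc (k + r)) 0  ≡⟨ latticeCount-suc-zero (k + m) b (suc k) (suc (k + r)) ⟩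
  latticeCount (k + m) b k (suc (k + r)) 0              ≡⟨ cong (λ s → latticeCount (k + m) b k s 0) (+-suc k r) ⟨
  latticeCount (k + m) b k (k + suc r) 0                ≡⟨ latticeCount≡latticeSum k m (suc r) 0 b (subst (_≤ b) (sym (+-suc k r)) k+r<b) ⟩
  latticeSum k m (suc r) 0                              ∎
latticeCount≡latticeSum (suc k) m r (suc j) (suc b) k+r<b = begin
  latticeCount (suc (k + m)) (suc b) (suc k) (suc (k + r)) (suc j)
    ≡⟨ latticeCount-binary (k + m) b k (k + r) j ⟩
  latticeCount (k + m) (suc b) k (suc (k + r)) (suc j) + latticeCount (k + m) (suc b) k (k + r) j
    ≡⟨ cong₂ _+_ (trans (cong (λ s → latticeCount (k + m) (suc b) k s (suc j)) (sym (+-suc k r)))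
                        (latticeCount≡latticeSum k m (suc r) (suc j) (suc b) (subst (_≤ suc b) (sym (+-suc k r)) k+r<b)))
                 (latticeCount≡latticeSum k m r j (suc b) (≤-trans (n≤1+n _) k+r<b)) ⟩
  latticeSum k m (suc r) (suc j) + latticeSum k m r j
    ≡⟨ latticeSum-pascal k m r j ⟨
  latticeSum (suc k) m r (suc j) ∎

subset-vandermonde : ∀ m d u j → d + u ≡ j →
  ∑ (suc j) (λ i → j choose i * (m choose i * (m ∸ i) choose u)) ≡ m choose u * (m + d) choose j
subset-vandermonde m d u j d+u≡j = begin
  ∑ (suc j) (λ i → j choose i * (m choose i * (m ∸ i) choose u))
    ≡⟨ ∑-cong (suc j) (λ i → trans (cong (j choose i *_) (choose-subset-comm m i u))
                                    (rotate (j choose i) (m choose u) ((m ∸ u) choose i))) ⟩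
  ∑ (suc j) (λ i → m choose u * ((m ∸ u) choose i * j choose i))
    ≡⟨ ∑-distribˡ-* (suc j) (m choose u) (λ i → (m ∸ u) choose i * j choose i) ⟨
  m choose u * ∑ (suc j) (λ i → (m ∸ u) choose i * j choose i)
    ≡⟨ cong (m choose u *_) (vandermonde-square (m ∸ u) j) ⟩
  m choose u * (m ∸ u + j) choose j
    ≡⟨ shrink (u ≤? m) ⟩
  m choose u * (m + d) choose j ∎
  where
  rotate : ∀ a b c → a * (b * c) ≡ b * (c * a)
  rotate = solve-∀
  shrink : Dec (u ≤ m) → m choose u * (m ∸ u + j) choose j ≡ m choose u * (m + d) choose j
  shrink (yes u≤m) = cong (λ z → m choose u * z choose j) (begin
    m ∸ u + j         ≡⟨ cong (m ∸ u +_) (trans (sym d+u≡j) (+-comm d u)) ⟩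
    m ∸ u + (u + d)   ≡⟨ +-assoc (m ∸ u) u d ⟨
    m ∸ u + u + d     ≡⟨ cong (_+ d) (m∸n+n≡m u≤m) ⟩
    m + d             ∎)
  shrink (no u≰m) rewrite choose-vanish (≰⇒> u≰m) = refl

revisedTerm : ℕ → ℕ → ℕ → ℕ → ℕ
revisedTerm k m j i = m choose i * j choose i * (k + (m ∸ i)) choose j

revisedSum : ℕ → ℕ → ℕ → ℕ
revisedSum k m j = ∑ (suc j) (revisedTerm k m j)

latticeSum≡revisedSum : ∀ k m j → latticeSum k m m j ≡ revisedSum k m j
latticeSum≡revisedSum k m j = sym (begin
  ∑ (suc j) (λ i → m choose i * j choose i * (k + (m ∸ i)) choose j)
    ≡⟨ ∑-cong (suc j) (λ i → cong (m choose i * j choose i *_) (sym (vandermonde k (m ∸ i) j))) ⟩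
  ∑ (suc j) (λ i → m choose i * j choose i * conv j (λ d u → k choose d * (m ∸ i) choose u))
    ≡⟨ ∑-cong (suc j) (λ i → ∑-distribˡ-* (suc j) (m choose i * j choose i) (λ d → k choose d * (m ∸ i) choose (j ∸ d))) ⟩
  ∑ (suc j) (λ i → conv j (λ d u → m choose i * j choose i * (k choose d * (m ∸ i) choose u)))
    ≡⟨ ∑-comm (suc j) (suc j) (λ i d → m choose i * j choose i * (k choose d * (m ∸ i) choose (j ∸ d))) ⟩
  conv j (λ d u → ∑ (suc j) (λ i → m choose i * j choose i * (k choose d * (m ∸ i) choose u)))
    ≡⟨ conv-cong j (λ d u d+u≡j → begin
         ∑ (suc j) (λ i → m choose i * j choose i * (k choose d * (m ∸ i) choose u))
           ≡⟨ ∑-cong (suc j) (λ i → rearrange (m choose i) (j choose i) (k choose d) ((m ∸ i) choose u)) ⟩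
         ∑ (suc j) (λ i → k choose d * (j choose i * (m choose i * (m ∸ i) choose u)))
           ≡⟨ ∑-distribˡ-* (suc j) (k choose d) (λ i → j choose i * (m choose i * (m ∸ i) choose u)) ⟨
         k choose d * ∑ (suc j) (λ i → j choose i * (m choose i * (m ∸ i) choose u))
           ≡⟨ cong (k choose d *_) (subset-vandermonde m d u j d+u≡j) ⟩
         k choose d * (m choose u * (m + d) choose j)
           ≡⟨ *-assoc (k choose d) _ _ ⟨
         k choose d * m choose u * (m + d) choose j ∎) ⟩
  latticeSum k m m j ∎)
  where
  rearrange : ∀ a b c x → a * b * (c * x) ≡ c * (b * (a * x))
  rearrange = solve-∀

revisedSum-vanish : ∀ k m j → k + m < j → revisedSum k m j ≡ 0
revisedSum-vanish k m j k+m<j = ∑-zero (suc j) (λ i →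
  trans (cong (m choose i * j choose i *_) (choose-vanish (≤-<-trans (+-monoʳ-≤ k (m∸n≤m m i)) k+m<j)))
        (*-zeroʳ (m choose i * j choose i)))

revisedTerm-vanish-j : ∀ k m j i → j < i → revisedTerm k m j i ≡ 0
revisedTerm-vanish-j k m j i j<i rewrite choose-vanish j<i = cong (_* (k + (m ∸ i)) choose j) (*-zeroʳ (m choose i))

choose*choose-∸-assoc : ∀ k m i j → m choose i * (k + m ∸ i) choose j ≡ m choose i * (k + (m ∸ i)) choose j
choose*choose-∸-assoc k m i j with i ≤? m
... | yes i≤m = cong (λ z → m choose i * z choose j) (+-∸-assoc k i≤m)
... | no  i≰m rewrite choose-vanish (≰⇒> i≰m) = refl

revisedTerm-vanish-half : ∀ k m j i → (k + m) / 2 < i → revisedTerm k m j i ≡ 0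
revisedTerm-vanish-half k m j i@(suc _) n/2<i with i ≤? j
... | no  i≰j = revisedTerm-vanish-j k m j i (≰⇒> i≰j)
... | yes i≤j = begin
  m choose i * j choose i * (k + (m ∸ i)) choose j  ≡⟨ swap (m choose i) (j choose i) _ ⟩
  m choose i * (k + (m ∸ i)) choose j * j choose i  ≡⟨ cong (_* j choose i) (choose*choose-∸-assoc k m i j) ⟨
  m choose i * (k + m ∸ i) choose j * j choose i    ≡⟨ cong (λ z → m choose i * z * j choose i) (choose-vanish n∸i<j) ⟩
  m choose i * 0 * j choose i                       ≡⟨ cong (_* j choose i) (*-zeroʳ (m choose i)) ⟩
  0                                                 ∎
  where
  swap : ∀ a b c → a * b * c ≡ a * c * b
  swap = solve-∀
  n<i+i : ∀ {i′} → (k + m) / 2 < suc i′ → k + m < suc i′ + suc i′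
  n<i+i {i′} (s≤s n/2≤i′) = s≤s (subst (k + m ≤_) (sym (+-suc i′ i′)) (n/2≤i⇒n≤1+i+i (k + m) i′ n/2≤i′))
  n∸i<j : k + m ∸ i < j
  n∸i<j = <-≤-trans (m<n+o⇒m∸n<o (k + m) i (n<i+i n/2<i)) i≤j

γτ : ℕ → ℕ → ℕ → ℕ
γτ n k i = ((n ∸ k) C i) * ((n ∸ i) C i)

γτ-term : ∀ k m j i → γτ (k + m) k i * shift i ((k + m ∸ 2 * i) choose_) j ≡ revisedTerm k m j i
γτ-term k m j i = trans (cong (_* shift i ((k + m ∸ 2 * i) choose_) j) γτ≡choose) (choose-form (i ≤? j))
  where
  N : ℕ
  N = k + m ∸ i
  γτ≡choose : γτ (k + m) k i ≡ m choose i * N choose i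
  γτ≡choose = cong₂ _*_ (trans (C≡choose (k + m ∸ k) i) (cong (_choose i) (m+n∸m≡n k m))) (C≡choose N i)
  choose-form : Dec (i ≤ j) → m choose i * N choose i * shift i ((k + m ∸ 2 * i) choose_) j ≡ revisedTerm k m j i
  choose-form (no i≰j) rewrite shift-> i ((k + m ∸ 2 * i) choose_) j (≰⇒> i≰j) =
    trans (*-zeroʳ (m choose i * N choose i)) (sym (revisedTerm-vanish-j k m j i (≰⇒> i≰j)))
  choose-form (yes i≤j) = begin
    m choose i * N choose i * shift i ((k + m ∸ 2 * i) choose_) j
      ≡⟨ cong (m choose i * N choose i *_) (shift-≤ i ((k + m ∸ 2 * i) choose_) j i≤j) ⟩
    m choose i * N choose i * (k + m ∸ 2 * i) choose (j ∸ i)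
      ≡⟨ cong (λ z → m choose i * N choose i * z choose (j ∸ i)) (trans (cong (λ z → k + m ∸ (i + z)) (+-identityʳ i)) (sym (∸-+-assoc (k + m) i i))) ⟩
    m choose i * N choose i * (N ∸ i) choose (j ∸ i)
      ≡⟨ *-assoc (m choose i) _ _ ⟩
    m choose i * (N choose i * (N ∸ i) choose (j ∸ i))
      ≡⟨ cong (m choose i *_) (choose-subset N i (j ∸ i)) ⟩
    m choose i * (N choose (i + (j ∸ i)) * (i + (j ∸ i)) choose i)
      ≡⟨ cong (λ z → m choose i * (N choose z * z choose i)) (m+[n∸m]≡n i≤j) ⟩
    m choose i * (N choose j * j choose i)
      ≡⟨ reorder (m choose i) (N choose j) (j choose i) ⟩
    m choose i * N choose j * j choose i
      ≡⟨ cong (_* j choose i) (choose*choose-∸-assoc k m i j) ⟩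
    m choose i * (k + (m ∸ i)) choose j * j choose i
      ≡⟨ reorder′ (m choose i) _ (j choose i) ⟩
    revisedTerm k m j i ∎
    where
    reorder : ∀ a b c → a * (b * c) ≡ a * b * c
    reorder = solve-∀
    reorder′ : ∀ a b c → a * b * c ≡ a * c * b
    reorder′ = solve-∀

γ-coeff≡revisedSum : ∀ k m j → γ-coeff (γτ (k + m) k) (k + m) j ≡ revisedSum k m j
γ-coeff≡revisedSum k m j = trans (∑-cong (suc q) (γτ-term k m j)) (same-range (≤-total (suc q) (suc j)))
  where
  q : ℕ
  q = (k + m) / 2
  same-range : suc q ≤ suc j ⊎ suc j ≤ suc q → ∑ (suc q) (revisedTerm k m j) ≡ revisedSum k m j
  same-range (inj₁ q≤j) = sym (∑-vanishing-tail q≤j (λ i → revisedTerm-vanish-half k m j i))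
  same-range (inj₂ j≤q) = ∑-vanishing-tail j≤q (λ i → revisedTerm-vanish-j k m j i)

coeff-hpoly≡revisedSum : ∀ k m j → coeff (hpoly (k + m) k) j ≡ revisedSum k m j
coeff-hpoly≡revisedSum k m j with j ≤? k + m
... | yes j≤n = begin
  coeff (hpoly n k) j                      ≡⟨ coeff-sumₚ-monomials n (hcoeff n k) j ⟩
  ∑ (suc n) (λ i → hcoeff n k i * δ i j)   ≡⟨ ∑-δ (suc n) (hcoeff n k) j (s≤s j≤n) ⟩
  hcoeff n k j                             ≡⟨ hcoeff≡latticeCount n k j ⟩
  latticeCount n n k n j                   ≡⟨ latticeCount≡latticeSum k m m j n ≤-refl ⟩
  latticeSum k m m j                       ≡⟨ latticeSum≡revisedSum k m j ⟩
  revisedSum k m j                         ∎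
  where
    n : ℕ
    n = k + m
... | no j≰n = trans (coeff-sumₚ-monomials (k + m) (hcoeff (k + m) k) j)
  (trans (∑-δ-out (suc (k + m)) (hcoeff (k + m) k) j (≰⇒> j≰n)) (sym (revisedSum-vanish k m j (≰⇒> j≰n))))

hpoly≈γ-expansion : ∀ n k → k ≤ n → ∀ j → coeff (hpoly n k) j ≡ coeff (γ-expansion (γτ n k) n) j
hpoly≈γ-expansion n k k≤n j =
  subst (λ n → coeff (hpoly n k) j ≡ coeff (γ-expansion (γτ n k) n) j) (m+[n∸m]≡n k≤n) (begin
    coeff (hpoly (k + m) k) j                          ≡⟨ coeff-hpoly≡revisedSum k m j ⟩
    revisedSum k m j                                   ≡⟨ γ-coeff≡revisedSum k m j ⟨
    γ-coeff (γτ (k + m) k) (k + m) j                   ≡⟨ coeff-γ-expansion (γτ (k + m) k) (k + m) j ⟨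
    coeff (γ-expansion (γτ (k + m) k) (k + m)) j       ∎)
  where
    m : ℕ
    m = n ∸ k

proposition2p2 : (n k : ℕ) → 0 < n → k ≤ n →
    ((j : ℕ) → coeff (hpoly n k) j
        ≡ coeff (sumₚ (n / 2) (λ i → (((n ∸ k) C i) * ((n ∸ i) C i))
                                     ·ₚ ((tₚ ^ₚ i) *ₚ ((oneₚ +ₚ tₚ) ^ₚ (n ∸ 2 * i))))) j)
    × GammaPositive n (hpoly n k)
    × Palindromic n (hpoly n k)
    × Unimodal (hpoly n k)
proposition2p2 n k _ k≤n =
  coeffs , γ-positive , γ-positive⇒palindromic n (hpoly n k) γ-positive , γ-positive⇒unimodal n (hpoly n k) γ-positive
  where
  coeffs : ∀ j → coeff (hpoly n k) j ≡ coeff (γ-expansion (γτ n k) n) j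
  coeffs = hpoly≈γ-expansion n k k≤n
  γ-positive : GammaPositive n (hpoly n k)
  γ-positive = γτ n k , coeffs
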